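{- For every integer $k \ge 1$ there is a unique power series $f(x) = 1 + h_1 x + h_2 x^2 + \cdots$ with $h_n \in \{1, 2, \ldots, k\}$ for all $n \ge 1$ such that $f \in \mathcal{P}_k$ (i.e. $f = g^k$ for some $g \in R$). Equivalently, the sequence $H_k = (1, h_1, h_2, \ldots)$ defined by letting each $h_n$ be the smallest element of $\{1, \ldots, k\}$ for which the coefficients of $(1 + h_1 x + \cdots + h_n x^n)^{1/k}$ up to $x^n$ are integers is well-defined, and it is the unique such sequence.
   Context: $R := 1 + x\mathbb{Z}[[x]]$ is the set of formal power series with integer coefficients and constant term $1$, and $\mathcal{P}_k := \{ g^k \mid g \in R\}$. -}

module Defs where

open import Data.Nat using (ℕ; zero; suc)
open import Data.Integer using (ℤ; +_; _+_; _*_; _≤_)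
open import Relation.Binary.PropositionalEquality using (_≡_)
open import Data.Product using (Σ; _×_)

PowerSeries : Set
PowerSeries = ℕ → ℤ

_≐_ : PowerSeries → PowerSeries → Set
f ≐ g = ∀ n → f n ≡ g n

one : PowerSeries
one zero    = + 1
one (suc _) = + 0

-- Cauchy sum  Σ_{i+j=n} a i * b j  computed as Σ_{i=0}^{n} a i * b (n - i).
conv : PowerSeries → PowerSeries → ℕ → ℤ
conv a b zero    = a zero * b zero
conv a b (suc n) = a zero * b (suc n) + conv (λ i → a (suc i)) b n

_⊛_ : PowerSeries → PowerSeries → PowerSeries
(a ⊛ b) n = conv a b n

_^ₛ_ : PowerSeries → ℕ → PowerSeries
g ^ₛ zero    = one
g ^ₛ (suc k) = g ⊛ (g ^ₛ k)

InR : PowerSeries → Set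
InR g = g zero ≡ + 1

InP : ℕ → PowerSeries → Set
InP k f = Σ PowerSeries (λ g → InR g × (g ^ₛ k) ≐ f)

DigitsIn1toK : ℕ → PowerSeries → Set
DigitsIn1toK k f = f zero ≡ + 1 × (∀ n → (+ 1 ≤ f (suc n)) × (f (suc n) ≤ + k))

{-# OPTIONS --safe #-}
-- For g ∈ R, the coefficient of x^(n+1) in g^k is k·g(n+1) plus a quantity
-- depending only on g(1), …, g(n).  So the coefficients of a k-th root g can be
-- chosen one at a time, g(n+1) being the unique integer that moves this
-- coefficient of g^k into the complete residue system {1, …, k} modulo k.
module Submission where

open import Data.Empty using (⊥-elim)
open import Data.Integer.Base using (ℤ; +_; +[1+_]; -[1+_]; _+_; _*_; _-_; -_; +≤+; _≤_)
open import Data.Integer.DivMod using (_/ℕ_; _%ℕ_; a≡a%ℕn+[a/ℕn]*n; n%ℕd<d)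
import Data.Integer.Properties as ℤ
open import Data.Integer.Tactic.RingSolver using (solve-∀)
open import Data.Nat using (ℕ; zero; suc; NonZero; z≤n; s≤s)
open import Data.Nat.Base as ℕ using (_<_)
import Data.Nat.Properties as ℕ
open import Data.Product using (∃!; ∃-syntax; _×_; _,_; proj₁; proj₂)
open import Data.Sum using (inj₁; inj₂)
open import Relation.Binary.PropositionalEquality
open ≡-Reasoning

open import Defs

private variable
  a a' b b' c c' g g' : PowerSeries
  m n : ℕ

shift : PowerSeries → PowerSeries
shift a i = a (suc i)

_≐_mod-x^_ : PowerSeries → PowerSeries → ℕ → Set
a ≐ b mod-x^ n = ∀ {i} → i < n → a i ≡ b i

mod-x^-mono : m ℕ.≤ n → a ≐ b mod-x^ n → a ≐ b mod-x^ m
mod-x^-mono m≤n a≐b i<m = a≐b (ℕ.<-≤-trans i<m m≤n)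

mod-x^-extend : a ≐ b mod-x^ n → a n ≡ b n → a ≐ b mod-x^ suc n
mod-x^-extend a≐b aₙ≡bₙ i<1+n with ℕ.m<1+n⇒m<n∨m≡n i<1+n
... | inj₁ i<n  = a≐b i<n
... | inj₂ refl = aₙ≡bₙ

shift-mod-x^ : a ≐ b mod-x^ suc n → shift a ≐ shift b mod-x^ n
shift-mod-x^ a≐b i<n = a≐b (s≤s i<n)

conv-cong : a ≐ a' mod-x^ suc n → b ≐ b' mod-x^ suc n → conv a b n ≡ conv a' b' n
conv-cong {n = zero}  a≐a' b≐b' = cong₂ _*_ (a≐a' (s≤s z≤n)) (b≐b' (s≤s z≤n))
conv-cong {n = suc n} a≐a' b≐b' =
  cong₂ _+_ (cong₂ _*_ (a≐a' (s≤s z≤n)) (b≐b' ℕ.≤-refl))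
            (conv-cong (shift-mod-x^ a≐a') (mod-x^-mono (ℕ.n≤1+n _) b≐b'))

⊛-cong : a ≐ a' mod-x^ n → b ≐ b' mod-x^ n → (a ⊛ b) ≐ (a' ⊛ b') mod-x^ n
⊛-cong a≐a' b≐b' i<n = conv-cong (mod-x^-mono i<n a≐a') (mod-x^-mono i<n b≐b')

^ₛ-cong : ∀ k → g ≐ g' mod-x^ n → (g ^ₛ k) ≐ (g' ^ₛ k) mod-x^ n
^ₛ-cong zero    _    _ = refl
^ₛ-cong (suc k) g≐g'   = ⊛-cong g≐g' (^ₛ-cong k g≐g')

InR-^ₛ : ∀ k → InR g → InR (g ^ₛ k)
InR-^ₛ zero    g₀≡1 = refl
InR-^ₛ (suc k) g₀≡1 = cong₂ _*_ g₀≡1 (InR-^ₛ k g₀≡1)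

_⊕_ : PowerSeries → PowerSeries → PowerSeries
(a ⊕ b) i = a i + b i

_x^_ : ℤ → ℕ → PowerSeries
(c x^ zero)  zero    = c
(c x^ zero)  (suc i) = + 0
(c x^ suc n) zero    = + 0
(c x^ suc n) (suc i) = (c x^ n) i

x^-coeff : ∀ c n → (c x^ n) n ≡ c
x^-coeff c zero    = refl
x^-coeff c (suc n) = x^-coeff c n

x^-below : ∀ c {i} → i < n → (c x^ n) i ≡ + 0
x^-below {suc n} c {zero}  _         = refl
x^-below {suc n} c {suc i} (s≤s i<n) = x^-below c i<n

⊕-x^-mod : ∀ a c → (a ⊕ (c x^ n)) ≐ a mod-x^ n
⊕-x^-mod a c {i} i<n = trans (cong (_+_ (a i)) (x^-below c i<n)) (ℤ.+-identityʳ (a i))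

conv-diff : c ≐ c' mod-x^ n → shift b ≐ shift b' mod-x^ n →
  conv c b n - conv c' b' n ≡ c n * b 0 - c' n * b' 0
conv-diff {n = zero} _ _ = refl
conv-diff {c} {c'} {suc n} {b} {b'} c≐c' b≐b' = begin
  (c 0 * b (suc n) + conv (shift c) b n) - (c' 0 * b' (suc n) + conv (shift c') b' n)
    ≡⟨ cong (λ x → (x + conv (shift c) b n) - (c' 0 * b' (suc n) + conv (shift c') b' n))
            (cong₂ _*_ (c≐c' (s≤s z≤n)) (b≐b' ℕ.≤-refl)) ⟩
  (c' 0 * b' (suc n) + conv (shift c) b n) - (c' 0 * b' (suc n) + conv (shift c') b' n)
    ≡⟨ [p+x]-[p+y]≡x-y (c' 0 * b' (suc n)) _ _ ⟩
  conv (shift c) b n - conv (shift c') b' n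
    ≡⟨ conv-diff (shift-mod-x^ c≐c') (mod-x^-mono (ℕ.n≤1+n n) b≐b') ⟩
  c (suc n) * b 0 - c' (suc n) * b' 0
    ∎
  where
  [p+x]-[p+y]≡x-y : ∀ p x y → (p + x) - (p + y) ≡ x - y
  [p+x]-[p+y]≡x-y = solve-∀

^ₛ-coeff-diff : ∀ k → InR g → g ≐ g' mod-x^ suc m →
  (g ^ₛ k) (suc m) - (g' ^ₛ k) (suc m) ≡ + k * (g (suc m) - g' (suc m))
^ₛ-coeff-diff zero _ _ = refl
^ₛ-coeff-diff {g} {g'} {m} (suc k) g₀≡1 g≐g' = begin
  (g 0 * G (suc m) + conv (shift g) G m) - (g' 0 * G' (suc m) + conv (shift g') G' m)
    ≡⟨ cong₂ (λ x y → (x * G (suc m) + conv (shift g) G m) - (y * G' (suc m) + conv (shift g') G' m))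
             g₀≡1 g'₀≡1 ⟩
  (+ 1 * G (suc m) + conv (shift g) G m) - (+ 1 * G' (suc m) + conv (shift g') G' m)
    ≡⟨ regroup (G (suc m)) (G' (suc m)) (conv (shift g) G m) (conv (shift g') G' m) ⟩
  (G (suc m) - G' (suc m)) + (conv (shift g) G m - conv (shift g') G' m)
    ≡⟨ cong₂ _+_ (^ₛ-coeff-diff k g₀≡1 g≐g')
                 (conv-diff (shift-mod-x^ g≐g') (shift-mod-x^ (^ₛ-cong k g≐g'))) ⟩
  + k * (g (suc m) - g' (suc m)) + (g (suc m) * G 0 - g' (suc m) * G' 0)
    ≡⟨ cong₂ (λ x y → + k * (g (suc m) - g' (suc m)) + (g (suc m) * x - g' (suc m) * y))
             (InR-^ₛ k g₀≡1) (InR-^ₛ k g'₀≡1) ⟩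
  + k * (g (suc m) - g' (suc m)) + (g (suc m) * + 1 - g' (suc m) * + 1)
    ≡⟨ collect (+ k) (g (suc m)) (g' (suc m)) ⟩
  + suc k * (g (suc m) - g' (suc m))
    ∎
  where
  G  = g ^ₛ k
  G' = g' ^ₛ k
  g'₀≡1 : InR g'
  g'₀≡1 = trans (sym (g≐g' (s≤s z≤n))) g₀≡1
  regroup : ∀ x x' y y' → (+ 1 * x + y) - (+ 1 * x' + y') ≡ (x - x') + (y - y')
  regroup = solve-∀
  collect : ∀ k x y → k * (x - y) + (x * + 1 - y * + 1) ≡ (+ 1 + k) * (x - y)
  collect = solve-∀

a≡b+[a-b] : ∀ a b → a ≡ b + (a - b)
a≡b+[a-b] = solve-∀

Digit : ℕ → ℤ → Set
Digit k a = + 1 ≤ a × a ≤ + k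

digit-shift : ∀ k .{{_ : NonZero k}} c → ∃[ t ] Digit k (c + + k * t)
digit-shift k c =
  - q , subst (Digit k) (sym c+k*[-q]≡1+r) (+≤+ (s≤s z≤n) , +≤+ (n%ℕd<d (c - + 1) k))
  where
  q = (c - + 1) /ℕ k
  r = (c - + 1) %ℕ k
  c+k*[-q]≡1+r : c + + k * - q ≡ + 1 + + r
  c+k*[-q]≡1+r = begin
    c + + k * - q                     ≡⟨ expand c (+ k) q ⟩
    + 1 + ((c - + 1) - q * + k)       ≡⟨ cong (λ x → + 1 + (x - q * + k)) (a≡a%ℕn+[a/ℕn]*n (c - + 1) k) ⟩
    + 1 + ((+ r + q * + k) - q * + k) ≡⟨ cancel (+ r) (q * + k) ⟩
    + 1 + + r                         ∎
    where
    expand : ∀ c k q → c + k * - q ≡ + 1 + ((c - + 1) - q * k)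
    expand = solve-∀
    cancel : ∀ r s → + 1 + ((r + s) - s) ≡ + 1 + r
    cancel = solve-∀

digit-gap : ∀ {k a b} m → Digit k a → Digit k b → a ≢ b + + k * +[1+ m ]
digit-gap {k} {b = + b'} m (_ , +≤+ a'≤k) (+≤+ 1≤b' , _) a≡b+k[1+m] =
  ℕ.≤⇒≯ a'≤k (subst (k <_) (sym a'≡b'+k[1+m]) (ℕ.+-mono-≤ 1≤b' (ℕ.m≤m*n k (suc m))))
  where
  a'≡b'+k[1+m] = ℤ.+-injective (trans a≡b+k[1+m] (cong (_+_ (+ b')) (sym (ℤ.pos-* k (suc m)))))

digit-unique : ∀ {k a b} d → Digit k a → Digit k b → a - b ≡ + k * d → d ≡ + 0
digit-unique (+ zero) _ _ _ = refl
digit-unique {a = a} {b} +[1+ m ] a∈ b∈ a-b≡kd =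
  ⊥-elim (digit-gap m a∈ b∈ (trans (a≡b+[a-b] a b) (cong (_+_ b) a-b≡kd)))
digit-unique {k} {a} {b} -[1+ m ] a∈ b∈ a-b≡kd = ⊥-elim (digit-gap m b∈ a∈ b≡a+k[1+m])
  where
  b≡a-[a-b] : ∀ a b → b ≡ a + - (a - b)
  b≡a-[a-b] = solve-∀
  b≡a+k[1+m] : b ≡ a + + k * +[1+ m ]
  b≡a+k[1+m] = begin
    b                      ≡⟨ b≡a-[a-b] a b ⟩
    a + - (a - b)          ≡⟨ cong (λ x → a + - x) a-b≡kd ⟩
    a + - (+ k * -[1+ m ]) ≡⟨ cong (_+_ a) (ℤ.neg-distribʳ-* (+ k) -[1+ m ]) ⟩
    a + + k * +[1+ m ]     ∎

digit-root-unique : ∀ k → InR g → InR g' →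
  (∀ n → Digit k ((g ^ₛ k) (suc n))) → (∀ n → Digit k ((g' ^ₛ k) (suc n))) →
  ∀ n → g ≐ g' mod-x^ suc n
digit-root-unique {g} {g'} k g₀≡1 g'₀≡1 _ _ zero =
  mod-x^-extend {a = g} {b = g'} (λ ()) (trans g₀≡1 (sym g'₀≡1))
digit-root-unique {g} {g'} k g₀≡1 g'₀≡1 g-digits g'-digits (suc m) =
  mod-x^-extend {a = g} {b = g'} g≐g' (ℤ.i-j≡0⇒i≡j _ _
    (digit-unique (g (suc m) - g' (suc m)) (g-digits m) (g'-digits m) (^ₛ-coeff-diff k g₀≡1 g≐g')))
  where
  g≐g' = digit-root-unique k g₀≡1 g'₀≡1 g-digits g'-digits m

module DigitRoot (k : ℕ) .{{_ : NonZero k}} where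

  correction : PowerSeries → ℕ → ℤ
  correction a n = proj₁ (digit-shift k ((a ^ₛ k) (suc n)))

  approx : ℕ → PowerSeries
  approx zero    = one
  approx (suc n) = approx n ⊕ (correction (approx n) n x^ suc n)

  root : PowerSeries
  root n = approx n n

  root≐approx : ∀ n → root ≐ approx n mod-x^ suc n
  root≐approx zero    = mod-x^-extend {a = root} {b = one} (λ ()) refl
  root≐approx (suc n) = mod-x^-extend {a = root} {b = approx (suc n)}
    (λ i<1+n → trans (root≐approx n i<1+n)
                     (sym (⊕-x^-mod (approx n) (correction (approx n) n) i<1+n)))
    refl

  root-coeff : ∀ n → root (suc n) - approx n (suc n) ≡ correction (approx n) n
  root-coeff n = begin
    (aₙ₊₁ + (t x^ suc n) (suc n)) - aₙ₊₁ ≡⟨ cong (λ x → (aₙ₊₁ + x) - aₙ₊₁) (x^-coeff t (suc n)) ⟩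
    (aₙ₊₁ + t) - aₙ₊₁                   ≡⟨ [a+t]-a≡t aₙ₊₁ t ⟩
    t                                   ∎
    where
    aₙ₊₁ = approx n (suc n)
    t    = correction (approx n) n
    [a+t]-a≡t : ∀ a t → (a + t) - a ≡ t
    [a+t]-a≡t = solve-∀

  root-digits : ∀ n → Digit k ((root ^ₛ k) (suc n))
  root-digits n = subst (Digit k) (sym root^k≡cₙ+kt) (proj₂ (digit-shift k cₙ))
    where
    cₙ = (approx n ^ₛ k) (suc n)
    root^k≡cₙ+kt : (root ^ₛ k) (suc n) ≡ cₙ + + k * correction (approx n) n
    root^k≡cₙ+kt = begin
      (root ^ₛ k) (suc n)
        ≡⟨ a≡b+[a-b] _ cₙ ⟩
      cₙ + ((root ^ₛ k) (suc n) - cₙ)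
        ≡⟨ cong (_+_ cₙ) (^ₛ-coeff-diff k refl (root≐approx n)) ⟩
      cₙ + + k * (root (suc n) - approx n (suc n))
        ≡⟨ cong (λ x → cₙ + + k * x) (root-coeff n) ⟩
      cₙ + + k * correction (approx n) n
        ∎

digit-root-exists : ∀ k .{{_ : NonZero k}} → ∃[ g ] InR g × (∀ n → Digit k ((g ^ₛ k) (suc n)))
digit-root-exists k = root , refl , root-digits
  where open DigitRoot k

theorem19 : (k : ℕ) → 1 Data.Nat.≤ k →
    ∃! _≐_ (λ f → DigitsIn1toK k f × InP k f)
theorem19 k 1≤k with digit-root-exists k {{ℕ.>-nonZero 1≤k}}
... | g , g₀≡1 , g-digits = g ^ₛ k , ((InR-^ₛ k g₀≡1 , g-digits) , (g , g₀≡1 , λ _ → refl)) , unique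
  where
  unique : ∀ {f} → DigitsIn1toK k f × InP k f → (g ^ₛ k) ≐ f
  unique ((_ , f-digits) , g' , g'₀≡1 , g'^k≐f) n =
    trans (^ₛ-cong k (digit-root-unique k g₀≡1 g'₀≡1 g-digits g'-digits n) ℕ.≤-refl) (g'^k≐f n)
    where
    g'-digits : ∀ m → Digit k ((g' ^ₛ k) (suc m))
    g'-digits m = subst (Digit k) (sym (g'^k≐f (suc m))) (f-digits m)
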